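{- Let $C$ be a guarded clause (respectively, a loosely guarded clause) and let $C'$ be obtained from $C$ by an application of the factoring rule Fact under the eligibility restrictions given in the context. Then $C'$ is a guarded clause (respectively, a loosely guarded clause).
   Context: Clauses are finite multisets of literals without equality. A compound term is a term that is neither a variable nor a constant. $\mathrm{Var}(E)$ is the set of variables of $E$. A literal is flat if every argument is a variable or constant; simple if every argument is a variable, a constant, or $f(u_1,\dots,u_n)$ with each $u_i$ a variable or constant. A clause is simple/flat if all its literals are; covering if every compound term $t$ in $C$ has $\mathrm{Var}(t)=\mathrm{Var}(C)$. A guarded clause is a simple covering clause that is ground or contains a negative flat literal $\neg G$ with $\mathrm{Var}(G)=\mathrm{Var}(C)$. A loosely guarded clause is a simple covering clause that is ground or contains a set $\mathcal G$ of negative flat literals such that each pair of variables of $C$ co-occurs in a literal of $\mathcal G$. Ordering: $\succ$ is a lexicographic path ordering with precedence function symbols $>$ constants $>$ predicate symbols, extended admissibly to literals; $L$ is maximal in $C$ if for some ground $\sigma$, $L\sigma\succeq L'\sigma$ for all other literals $L'$ of $C$. Selection in a (loosely) guarded clause $C$: nothing is selected if $C$ is ground, or if $C$ is non-ground, has no negative literal containing a compound term, and has a positive literal containing a compound term; in all other cases at least one negative literal is selected (a negative compound-term literal if one exists; otherwise a guard or top-variable literals). Fact: from $C=D\vee A_1\vee A_2$ in which no literal is selected and $A_1$ is maximal w.r.t. $C$, derive $(D\vee A_1)\sigma$ where $\sigma$ is a most general unifier of $A_1$ and $A_2$. -}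

module Defs where

open import Level using (0ℓ)
open import Data.Nat using (ℕ; _≤_)
open import Data.Bool using (Bool; true; false)
open import Data.Vec using (Vec; []; _∷_)
open import Data.Vec.Relation.Unary.Any using (Any)
open import Data.Vec.Relation.Unary.All using (All)
open import Data.List using (List; map) renaming ([] to []ₗ; _∷_ to _∷ₗ_)
open import Data.List.Membership.Propositional using (_∈_)
open import Data.List.Relation.Binary.Permutation.Propositional using (_↭_)
open import Data.Product using (Σ; ∃; _×_; _,_)
open import Data.Sum using (_⊎_)
open import Data.Unit using (⊤)
open import Data.Empty using (⊥)
open import Relation.Nullary using (¬_)
open import Relation.Binary using (Rel; IsStrictPartialOrder)
open import Relation.Binary.PropositionalEquality using (_≡_)
open import Function.Bundles using (_⇔_)

-- Signature: function symbols (positive arity), constants, predicate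
-- symbols, each with a precedence (strict partial order).
-- `g <F f` means f is greater than g in the precedence.

record Signature : Set₁ where
  field
    Fun Const Pred : Set
    funArity     : Fun → ℕ
    funArity-pos : ∀ f → 1 ≤ funArity f
    predArity    : Pred → ℕ
    _<F_ : Rel Fun 0ℓ
    _<C_ : Rel Const 0ℓ
    _<P_ : Rel Pred 0ℓ
    <F-spo : IsStrictPartialOrder _≡_ _<F_
    <C-spo : IsStrictPartialOrder _≡_ _<C_
    <P-spo : IsStrictPartialOrder _≡_ _<P_

module _ (S : Signature) where
  open Signature S

  -- Terms, atoms, literals, clauses (clauses = lists read as multisets)

  data Term : Set where
    var : ℕ → Term
    cst : Const → Term
    fun : (f : Fun) → Vec Term (funArity f) → Term

  record Atom : Set where
    constructor _⦅_⦆
    field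
      pred : Pred
      args : Vec Term (predArity pred)

  record Literal : Set where
    constructor lit
    field
      positive : Bool
      atom     : Atom

  Clause : Set
  Clause = List Literal

  Negative : Literal → Set
  Negative L = Literal.positive L ≡ false

  Positive : Literal → Set
  Positive L = Literal.positive L ≡ true

  data _⊴_ : Term → Term → Set where
    ⊴-refl : ∀ {t} → t ⊴ t
    ⊴-fun  : ∀ {s f ts} → Any (s ⊴_) ts → s ⊴ fun f ts

  data Compound : Term → Set where
    compound : ∀ f ts → Compound (fun f ts)

  _∈ₜL_ : Term → Literal → Set
  t ∈ₜL L = Any (t ⊴_) (Atom.args (Literal.atom L))

  _∈ₜC_ : Term → Clause → Set
  t ∈ₜC C = Σ Literal λ L → L ∈ C × t ∈ₜL L

  VarT : ℕ → Term → Set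
  VarT x t = var x ⊴ t

  VarL : ℕ → Literal → Set
  VarL x L = var x ∈ₜL L

  VarC : ℕ → Clause → Set
  VarC x C = var x ∈ₜC C

  GroundC : Clause → Set
  GroundC C = ∀ x → ¬ VarC x C

  data VarOrConst : Term → Set where
    isVar : ∀ x → VarOrConst (var x)
    isCst : ∀ c → VarOrConst (cst c)

  data SimpleArg : Term → Set where
    flatArg : ∀ {t} → VarOrConst t → SimpleArg t
    shallow : ∀ {f us} → All VarOrConst us → SimpleArg (fun f us)

  FlatL : Literal → Set
  FlatL L = All VarOrConst (Atom.args (Literal.atom L))

  SimpleL : Literal → Set
  SimpleL L = All SimpleArg (Atom.args (Literal.atom L))

  SimpleC : Clause → Set
  SimpleC C = ∀ L → L ∈ C → SimpleL L

  Covering : Clause → Set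
  Covering C = ∀ t → t ∈ₜC C → Compound t → ∀ x → (VarT x t ⇔ VarC x C)

  Guarded : Clause → Set
  Guarded C =
    SimpleC C × Covering C ×
    (GroundC C ⊎
     Σ Literal λ G → G ∈ C × Negative G × FlatL G × (∀ x → VarL x G ⇔ VarC x C))

  LooselyGuarded : Clause → Set
  LooselyGuarded C =
    SimpleC C × Covering C ×
    (GroundC C ⊎
     Σ (List Literal) λ 𝒢 →
       (∀ G → G ∈ 𝒢 → G ∈ C × Negative G × FlatL G) ×
       (∀ x y → VarC x C → VarC y C →
          Σ Literal λ G → G ∈ 𝒢 × VarL x G × VarL y G))

  Subst : Set
  Subst = ℕ → Term

  mutual
    subT : Subst → Term → Term
    subT σ (var x)    = σ x
    subT σ (cst c)    = cst c
    subT σ (fun f ts) = fun f (subTs σ ts)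

    subTs : ∀ {n} → Subst → Vec Term n → Vec Term n
    subTs σ []       = []
    subTs σ (t ∷ ts) = subT σ t ∷ subTs σ ts

  subA : Subst → Atom → Atom
  subA σ (P ⦅ ts ⦆) = P ⦅ subTs σ ts ⦆

  subL : Subst → Literal → Literal
  subL σ (lit b A) = lit b (subA σ A)

  subC : Subst → Clause → Clause
  subC σ C = map (subL σ) C

  GroundSubst : Subst → Set
  GroundSubst θ = ∀ x y → ¬ VarT y (θ x)

  IsMGU : Subst → Atom → Atom → Set
  IsMGU σ A B =
    subA σ A ≡ subA σ B ×
    (∀ τ → subA τ A ≡ subA τ B → Σ Subst λ ρ → ∀ x → τ x ≡ subT ρ (σ x))

  -- Lexicographic path ordering.  Terms and atoms are embedded into a
  -- single term algebra whose head symbols have precedence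
  -- function symbols > constants > predicate symbols.

  data Head : Set where
    hF : Fun → Head
    hC : Const → Head
    hP : Pred → Head

  arH : Head → ℕ
  arH (hF f) = funArity f
  arH (hC c) = 0
  arH (hP p) = predArity p

  data _⊐_ : Head → Head → Set where
    F⊐F : ∀ {f g} → g <F f → hF f ⊐ hF g
    F⊐C : ∀ {f c} → hF f ⊐ hC c
    F⊐P : ∀ {f p} → hF f ⊐ hP p
    C⊐C : ∀ {c d} → d <C c → hC c ⊐ hC d
    C⊐P : ∀ {c p} → hC c ⊐ hP p
    P⊐P : ∀ {p q} → q <P p → hP p ⊐ hP q

  data T : Set where
    v    : ℕ → T
    node : (h : Head) → Vec T (arH h) → T

  mutual
    ⌜_⌝ : Term → T
    ⌜ var x ⌝    = v x
    ⌜ cst c ⌝    = node (hC c) []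
    ⌜ fun f ts ⌝ = node (hF f) ⌜ ts ⌝*

    ⌜_⌝* : ∀ {n} → Vec Term n → Vec T n
    ⌜ [] ⌝*     = []
    ⌜ t ∷ ts ⌝* = ⌜ t ⌝ ∷ ⌜ ts ⌝*

  ⌜_⌝A : Atom → T
  ⌜ P ⦅ ts ⦆ ⌝A = node (hP P) ⌜ ts ⌝*

  data _occT_ (x : ℕ) : T → Set where
    occ-here : x occT v x
    occ-node : ∀ {h ss} → Any (x occT_) ss → x occT node h ss

  data _≻T_ : T → T → Set
  data _⪰T_ : T → T → Set
  data Lex : ∀ {n} → Vec T n → Vec T n → Set

  data _≻T_ where
    lpo1  : ∀ {h ss x} → x occT node h ss → node h ss ≻T v x
    lpo2a : ∀ {h ss t} → Any (_⪰T t) ss → node h ss ≻T t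
    lpo2b : ∀ {h g ss ts} → h ⊐ g → All (node h ss ≻T_) ts →
            node h ss ≻T node g ts
    lpo2c : ∀ {h ss ts} → All (node h ss ≻T_) ts → Lex ss ts →
            node h ss ≻T node h ts

  data _⪰T_ where
    ⪰-strict : ∀ {s t} → s ≻T t → s ⪰T t
    ⪰-refl   : ∀ {s} → s ⪰T s

  data Lex where
    lex-here  : ∀ {n s t} {ss ts : Vec T n} → s ≻T t → Lex (s ∷ ss) (t ∷ ts)
    lex-there : ∀ {n t} {ss ts : Vec T n} → Lex ss ts → Lex (t ∷ ss) (t ∷ ts)

  _≻A_ : Atom → Atom → Set
  A ≻A B = ⌜ A ⌝A ≻T ⌜ B ⌝A

  -- admissible extension to literals (multiset extension of ≻ with
  -- A ↦ {A}, ¬A ↦ {A, A}): compare atoms, and ¬A ≻ A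
  data _≻L_ : Literal → Literal → Set where
    byAtom : ∀ {b b' A B} → A ≻A B → lit b A ≻L lit b' B
    negPos : ∀ {A} → lit false A ≻L lit true A

  _⪰L_ : Literal → Literal → Set
  L ⪰L L' = L ≻L L' ⊎ L ≡ L'

  MaximalAmong : Literal → Clause → Set
  MaximalAmong L others =
    Σ Subst λ θ → GroundSubst θ × (∀ L' → L' ∈ others → subL θ L ⪰L subL θ L')

  HasCompound : Literal → Set
  HasCompound L = Σ Term λ t → t ∈ₜL L × Compound t

  NothingSelectedCase : Clause → Set
  NothingSelectedCase C =
    GroundC C ⊎
    (¬ GroundC C ×
     (∀ L → L ∈ C → Negative L → ¬ HasCompound L) ×
     Σ Literal λ L → L ∈ C × Positive L × HasCompound L)

  -- A selection function obeying the restrictions on (loosely) guarded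
  -- clauses (every guarded clause is loosely guarded).
  record Selection : Set where
    field
      sel      : Clause → List Literal
      sel-neg  : ∀ C L → L ∈ sel C → L ∈ C × Negative L
      sel-none : ∀ C → LooselyGuarded C → NothingSelectedCase C → sel C ≡ []ₗ
      sel-some : ∀ C → LooselyGuarded C → ¬ NothingSelectedCase C →
                 Σ Literal λ L → L ∈ sel C
      sel-cmp  : ∀ C → LooselyGuarded C → ¬ NothingSelectedCase C →
                 (Σ Literal λ L → L ∈ C × Negative L × HasCompound L) →
                 Σ Literal λ L → L ∈ sel C × HasCompound L

  record Fact (Sel : Selection) (C C' : Clause) : Set where
    field
      A₁ A₂   : Atom
      D       : Clause
      σ       : Subst
      shape   : C ↭ (lit true A₁ ∷ₗ lit true A₂ ∷ₗ D)
      noSel   : Selection.sel Sel C ≡ []ₗ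
      maximal : MaximalAmong (lit true A₁) (lit true A₂ ∷ₗ D)
      mgu     : IsMGU σ A₁ A₂
      result  : C' ≡ subC σ (lit true A₁ ∷ₗ D)

module Submission where

-- Let C = D ∨ A₁ ∨ A₂ be simple and covering and σ a most general unifier
-- of A₁ and A₂.  The heart of the proof is that σ is flat: it sends every
-- variable to a variable or a constant.  Indeed, the substitution τ that
-- agrees with σ except that it collapses compound images to a variable still
-- unifies A₁ and A₂: a pair of arguments f(ū) / g(v̄) forces f = g and equal
-- images of ū and v̄, while a pair f(ū) / z is impossible, since covering
-- puts z inside f(ū) and σz would be a proper subterm of itself.  As σ is
-- most general, τ = σρ for some ρ, which forces every σx to be flat.
--
-- A flat substitution maps simple literals to simple ones and flat ones to
-- flat ones, every compound subterm of an instance Eσ is the instance of a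
-- compound subterm of E, and every variable of Eσ occurs in the image of a
-- variable of E.  Hence for every E ⊆ C that keeps all negative literals of
-- C (the guards), Eσ is (loosely) guarded whenever C is.  The conclusion
-- (D ∨ A₁)σ of Fact is such an instance, because A₁ and A₂ are positive.

open import Defs
open import Data.Product using (_×_; Σ; _,_)
open import Data.Bool using (true)
open import Data.Sum using (inj₁; inj₂)
open import Data.Nat using (ℕ; suc; _+_; _≤_; s≤s)
open import Data.Nat.Properties using (≤-refl; ≤-trans; m≤m+n; m≤n+m; m≤n⇒m≤1+n; <-irrefl)
open import Data.Vec using (Vec; []; _∷_)
open import Data.Vec.Properties using (∷-injectiveˡ; ∷-injectiveʳ)
open import Data.Vec.Relation.Unary.Any using (Any; here; there)
open import Data.Vec.Relation.Unary.All using (All; []; _∷_)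
open import Data.List using (map; _∷_)
open import Data.List.Membership.Propositional using (_∈_)
open import Data.List.Membership.Propositional.Properties using (∈-map⁺; ∈-map⁻)
open import Data.List.Relation.Binary.Subset.Propositional using (_⊆_)
open import Data.List.Relation.Binary.Permutation.Propositional using (↭-sym)
open import Data.List.Relation.Binary.Permutation.Propositional.Properties using (∈-resp-↭)
import Data.List.Relation.Unary.Any as ListAny
open import Data.Empty using (⊥; ⊥-elim)
open import Relation.Binary.PropositionalEquality using (_≡_; refl; sym; cong; cong₂; subst; module ≡-Reasoning)
open import Function.Bundles using (_⇔_; mk⇔; Equivalence)

module _ (S : Signature) where

  infix 4 _⊑_ _⊑ˡ_ _⊑ᶜ_

  _⊑_ : Term S → Term S → Set
  _⊑_ = _⊴_ S

  _⊑ˡ_ : Term S → Literal S → Set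
  _⊑ˡ_ = _∈ₜL_ S

  _⊑ᶜ_ : Term S → Clause S → Set
  _⊑ᶜ_ = _∈ₜC_ S

  mutual
    ⊑-trans : ∀ {s t u} → s ⊑ t → t ⊑ u → s ⊑ u
    ⊑-trans p ⊴-refl    = p
    ⊑-trans p (⊴-fun q) = ⊴-fun (⊑-trans-any p q)

    ⊑-trans-any : ∀ {n s t} {us : Vec (Term S) n} →
                  s ⊑ t → Any (t ⊑_) us → Any (s ⊑_) us
    ⊑-trans-any p (here q)  = here (⊑-trans p q)
    ⊑-trans-any p (there q) = there (⊑-trans-any p q)

  mutual
    size : Term S → ℕ
    size (var x)    = 0
    size (cst c)    = 0
    size (fun f ts) = suc (size* ts)

    size* : ∀ {n} → Vec (Term S) n → ℕ
    size* []       = 0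
    size* (t ∷ ts) = size t + size* ts

  mutual
    size-⊑ : ∀ {s t} → s ⊑ t → size s ≤ size t
    size-⊑ ⊴-refl    = ≤-refl
    size-⊑ (⊴-fun p) = m≤n⇒m≤1+n (size-args p)

    size-args : ∀ {n s} {ts : Vec (Term S) n} → Any (s ⊑_) ts → size s ≤ size* ts
    size-args {ts = t ∷ ts} (here p)  = ≤-trans (size-⊑ p) (m≤m+n (size t) (size* ts))
    size-args {ts = t ∷ ts} (there p) = ≤-trans (size-args p) (m≤n+m (size* ts) (size t))

  proper-subterm-irrefl : ∀ {s f ts} → Any (s ⊑_) ts → s ≡ fun f ts → ⊥
  proper-subterm-irrefl p refl = <-irrefl refl (s≤s (size-args p))

  mutual
    ⊑-subst : ∀ σ {s t} → s ⊑ t → subT S σ s ⊑ subT S σ t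
    ⊑-subst σ ⊴-refl    = ⊴-refl
    ⊑-subst σ (⊴-fun p) = ⊴-fun (⊑-subst-args σ p)

    ⊑-subst-args : ∀ σ {n s} {ts : Vec (Term S) n} →
                   Any (s ⊑_) ts → Any (subT S σ s ⊑_) (subTs S σ ts)
    ⊑-subst-args σ (here p)  = here (⊑-subst σ p)
    ⊑-subst-args σ (there p) = there (⊑-subst-args σ p)

  occurs-check : ∀ σ {z f us} → Any (var z ⊑_) us → subT S σ (fun f us) ≡ σ z → ⊥
  occurs-check σ p eq = proper-subterm-irrefl (⊑-subst-args σ p) (sym eq)

  mutual
    var-of-instance : ∀ σ {y} t → var y ⊑ subT S σ t →
                      Σ ℕ λ x → var x ⊑ t × var y ⊑ σ x
    var-of-instance σ (var x) p = x , ⊴-refl , p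
    var-of-instance σ (cst c) ()
    var-of-instance σ (fun f ts) (⊴-fun p) =
      let x , x∈ts , y∈σx = var-of-instance-args σ ts p in x , ⊴-fun x∈ts , y∈σx

    var-of-instance-args : ∀ σ {n y} (ts : Vec (Term S) n) → Any (var y ⊑_) (subTs S σ ts) →
                           Σ ℕ λ x → Any (var x ⊑_) ts × var y ⊑ σ x
    var-of-instance-args σ (t ∷ ts) (here p) =
      let x , x∈t , y∈σx = var-of-instance σ t p in x , here x∈t , y∈σx
    var-of-instance-args σ (t ∷ ts) (there p) =
      let x , x∈ts , y∈σx = var-of-instance-args σ ts p in x , there x∈ts , y∈σx

  var-of-instance-lit : ∀ σ {y} L → VarL S y (subL S σ L) →
                        Σ ℕ λ x → VarL S x L × var y ⊑ σ x
  var-of-instance-lit σ (lit b (P ⦅ ts ⦆)) = var-of-instance-args σ ts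

  instance-var-lit : ∀ σ {x y} L → VarL S x L → var y ⊑ σ x → VarL S y (subL S σ L)
  instance-var-lit σ (lit b (P ⦅ ts ⦆)) x∈L y∈σx = ⊑-trans-any y∈σx (⊑-subst-args σ x∈L)

  negative-instance : ∀ σ L → Negative S L → Negative S (subL S σ L)
  negative-instance σ (lit b A) neg = neg

  FlatSubst : Subst S → Set
  FlatSubst σ = ∀ x → VarOrConst S (σ x)

  flat-of-instance : ∀ ρ t → VarOrConst S (subT S ρ t) → VarOrConst S t
  flat-of-instance ρ (var x) _ = isVar x
  flat-of-instance ρ (cst c) _ = isCst c
  flat-of-instance ρ (fun f ts) ()

  factor-flat : ∀ σ τ ρ → FlatSubst τ → (∀ x → τ x ≡ subT S ρ (σ x)) → FlatSubst σ
  factor-flat σ τ ρ τ-flat factor x =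
    flat-of-instance ρ (σ x) (subst (VarOrConst S) (factor x) (τ-flat x))

  no-compound-below-flat : ∀ {t u} → VarOrConst S u → t ⊑ u → Compound S t → ⊥
  no-compound-below-flat (isVar x) ⊴-refl ()
  no-compound-below-flat (isCst c) ⊴-refl ()

  no-compound-below-flat* : ∀ {n t} {us : Vec (Term S) n} →
                            All (VarOrConst S) us → Any (t ⊑_) us → Compound S t → ⊥
  no-compound-below-flat* (u ∷ _)  (here p)  = no-compound-below-flat u p
  no-compound-below-flat* (_ ∷ us) (there p) = no-compound-below-flat* us p

  module FlatInstance {σ : Subst S} (σ-flat : FlatSubst σ) where

    flat-term : ∀ {t} → VarOrConst S t → VarOrConst S (subT S σ t)
    flat-term (isVar x) = σ-flat x
    flat-term (isCst c) = isCst c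

    flat-terms : ∀ {n} {ts : Vec (Term S) n} →
                 All (VarOrConst S) ts → All (VarOrConst S) (subTs S σ ts)
    flat-terms []       = []
    flat-terms (t ∷ ts) = flat-term t ∷ flat-terms ts

    simple-arg : ∀ {t} → SimpleArg S t → SimpleArg S (subT S σ t)
    simple-arg (flatArg t)  = flatArg (flat-term t)
    simple-arg (shallow us) = shallow (flat-terms us)

    simple-args : ∀ {n} {ts : Vec (Term S) n} →
                  All (SimpleArg S) ts → All (SimpleArg S) (subTs S σ ts)
    simple-args []       = []
    simple-args (t ∷ ts) = simple-arg t ∷ simple-args ts

    simple-literal : ∀ L → SimpleL S L → SimpleL S (subL S σ L)
    simple-literal (lit b (P ⦅ ts ⦆)) = simple-args

    flat-literal : ∀ L → FlatL S L → FlatL S (subL S σ L)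
    flat-literal (lit b (P ⦅ ts ⦆)) = flat-terms

    compound-of-instance : ∀ {t a} → SimpleArg S a → t ⊑ subT S σ a → Compound S t →
                           Σ (Term S) λ s → s ⊑ a × Compound S s × t ≡ subT S σ s
    compound-of-instance (flatArg a) p ct = ⊥-elim (no-compound-below-flat (flat-term a) p ct)
    compound-of-instance {a = fun f us} (shallow _) ⊴-refl _ =
      fun f us , ⊴-refl , compound f us , refl
    compound-of-instance (shallow us) (⊴-fun p) ct =
      ⊥-elim (no-compound-below-flat* (flat-terms us) p ct)

    compound-of-instance-args : ∀ {n t} {as : Vec (Term S) n} →
                                All (SimpleArg S) as → Any (t ⊑_) (subTs S σ as) → Compound S t →
                                Σ (Term S) λ s → Any (s ⊑_) as × Compound S s × t ≡ subT S σ s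
    compound-of-instance-args (a ∷ _) (here p) ct =
      let s , s⊑a , cs , eq = compound-of-instance a p ct in s , here s⊑a , cs , eq
    compound-of-instance-args (_ ∷ as) (there p) ct =
      let s , s∈as , cs , eq = compound-of-instance-args as p ct in s , there s∈as , cs , eq

    compound-of-instance-lit : ∀ {t} L → SimpleL S L → t ⊑ˡ subL S σ L → Compound S t →
                               Σ (Term S) λ s → s ⊑ˡ L × Compound S s × t ≡ subT S σ s
    compound-of-instance-lit (lit b (P ⦅ ts ⦆)) = compound-of-instance-args

  -- Replace a compound term by a variable (which one is irrelevant).
  collapse : Term S → Term S
  collapse (var x)    = var x
  collapse (cst c)    = cst c
  collapse (fun f ts) = var 0

  collapse-flat : ∀ t → VarOrConst S (collapse t)
  collapse-flat (var x)    = isVar x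
  collapse-flat (cst c)    = isCst c
  collapse-flat (fun f ts) = isVar 0

  fun-injectiveˡ : ∀ {f g xs ys} → fun {S} f xs ≡ fun g ys → f ≡ g
  fun-injectiveˡ refl = refl

  fun-injectiveʳ : ∀ {f xs ys} → fun {S} f xs ≡ fun f ys → xs ≡ ys
  fun-injectiveʳ refl = refl

  pred-injective : ∀ {A B : Atom S} → A ≡ B → Atom.pred A ≡ Atom.pred B
  pred-injective refl = refl

  args-injective : ∀ {P xs ys} → _≡_ {A = Atom S} (P ⦅ xs ⦆) (P ⦅ ys ⦆) → xs ≡ ys
  args-injective refl = refl

  module Collapse (σ : Subst S) {C : Clause S} (covering : Covering S C) where

    τ : Subst S
    τ x = collapse (σ x)

    collapse-commutes : ∀ {t} → VarOrConst S t → subT S τ t ≡ collapse (subT S σ t)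
    collapse-commutes (isVar x) = refl
    collapse-commutes (isCst c) = refl

    collapse-agrees : ∀ {t w} → VarOrConst S t → VarOrConst S w →
                      subT S σ t ≡ subT S σ w → subT S τ t ≡ subT S τ w
    collapse-agrees {t} {w} t-flat w-flat eq = begin
      subT S τ t            ≡⟨ collapse-commutes t-flat ⟩
      collapse (subT S σ t) ≡⟨ cong collapse eq ⟩
      collapse (subT S σ w) ≡⟨ collapse-commutes w-flat ⟨
      subT S τ w            ∎
      where open ≡-Reasoning

    collapse-agrees* : ∀ {n} {us vs : Vec (Term S) n} → All (VarOrConst S) us → All (VarOrConst S) vs →
                       subTs S σ us ≡ subTs S σ vs → subTs S τ us ≡ subTs S τ vs
    collapse-agrees* []       []       eq = refl
    collapse-agrees* (u ∷ us) (w ∷ ws) eq =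
      cong₂ _∷_ (collapse-agrees u w (∷-injectiveˡ eq)) (collapse-agrees* us ws (∷-injectiveʳ eq))

    covered-var : ∀ {f us z} → fun f us ⊑ᶜ C → var z ⊑ᶜ C → Any (var z ⊑_) us
    covered-var {f} {us} {z} occ occ-z
      with Equivalence.from (covering (fun f us) occ (compound f us) z) occ-z
    ... | ⊴-fun z∈us = z∈us

    collapse-agrees-simple : ∀ {t w} → SimpleArg S t → SimpleArg S w → t ⊑ᶜ C → w ⊑ᶜ C →
                             subT S σ t ≡ subT S σ w → subT S τ t ≡ subT S τ w
    collapse-agrees-simple (flatArg t) (flatArg w) _ _ eq = collapse-agrees t w eq
    collapse-agrees-simple (shallow {f} us) (shallow vs) _ _ eq with fun-injectiveˡ eq
    ... | refl = cong (fun f) (collapse-agrees* us vs (fun-injectiveʳ eq))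
    collapse-agrees-simple (shallow _) (flatArg (isVar z)) occ occ-z eq =
      ⊥-elim (occurs-check σ (covered-var occ occ-z) eq)
    collapse-agrees-simple (flatArg (isVar z)) (shallow _) occ-z occ eq =
      ⊥-elim (occurs-check σ (covered-var occ occ-z) (sym eq))
    collapse-agrees-simple (shallow _) (flatArg (isCst c)) _ _ ()
    collapse-agrees-simple (flatArg (isCst c)) (shallow _) _ _ ()

    collapse-agrees-args : ∀ {n} {ts ws : Vec (Term S) n} →
                           All (SimpleArg S) ts → All (SimpleArg S) ws →
                           (∀ {t} → Any (t ⊑_) ts → t ⊑ᶜ C) → (∀ {w} → Any (w ⊑_) ws → w ⊑ᶜ C) →
                           subTs S σ ts ≡ subTs S σ ws → subTs S τ ts ≡ subTs S τ ws
    collapse-agrees-args [] [] _ _ eq = refl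
    collapse-agrees-args (t ∷ ts) (w ∷ ws) occ-ts occ-ws eq =
      cong₂ _∷_
        (collapse-agrees-simple t w (occ-ts (here ⊴-refl)) (occ-ws (here ⊴-refl)) (∷-injectiveˡ eq))
        (collapse-agrees-args ts ws (λ p → occ-ts (there p)) (λ p → occ-ws (there p)) (∷-injectiveʳ eq))

    collapse-unifies : SimpleC S C → ∀ {b b' A B} → lit b A ∈ C → lit b' B ∈ C →
                       subA S σ A ≡ subA S σ B → subA S τ A ≡ subA S τ B
    collapse-unifies simple {b} {b'} {P ⦅ xs ⦆} {Q ⦅ ys ⦆} A∈C B∈C eq with pred-injective eq
    ... | refl = cong (P ⦅_⦆)
      (collapse-agrees-args (simple _ A∈C) (simple _ B∈C)
        (λ p → _ , A∈C , p) (λ p → _ , B∈C , p) (args-injective eq))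

  mgu-flat : ∀ {C σ b b' A B} → SimpleC S C → Covering S C → lit b A ∈ C → lit b' B ∈ C →
             IsMGU S σ A B → FlatSubst σ
  mgu-flat {σ = σ} simple covering A∈C B∈C (unifies , most-general) =
    let ρ , factor = most-general τ (collapse-unifies simple A∈C B∈C unifies)
    in  factor-flat σ τ ρ (λ x → collapse-flat (σ x)) factor
    where open Collapse σ covering

  module SubclauseInstance {σ : Subst S} (σ-flat : FlatSubst σ) {C E : Clause S} (E⊆C : E ⊆ C) where
    open FlatInstance σ-flat

    literal-of-instance : ∀ {L'} → L' ∈ subC S σ E → Σ (Literal S) λ L → L ∈ C × L' ≡ subL S σ L
    literal-of-instance L'∈Eσ = let L , L∈E , eq = ∈-map⁻ (subL S σ) L'∈Eσ in L , E⊆C L∈E , eq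

    var-of-instance-clause : ∀ {y} → VarC S y (subC S σ E) → Σ ℕ λ x → VarC S x C × var y ⊑ σ x
    var-of-instance-clause (L' , L'∈Eσ , y∈L') with literal-of-instance L'∈Eσ
    ... | L , L∈C , refl =
      let x , x∈L , y∈σx = var-of-instance-lit σ L y∈L' in x , (L , L∈C , x∈L) , y∈σx

    instance-simple : SimpleC S C → SimpleC S (subC S σ E)
    instance-simple simple L' L'∈Eσ with literal-of-instance L'∈Eσ
    ... | L , L∈C , refl = simple-literal L (simple L L∈C)

    -- A compound term t of Eσ is sσ for a compound s of C; the variables of
    -- Eσ come from Var(C) = Var(s), so they all occur in t.
    instance-covering : SimpleC S C → Covering S C → Covering S (subC S σ E)
    instance-covering simple covering t (L' , L'∈Eσ , t∈L') t-compound y =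
      mk⇔ (λ y∈t → L' , L'∈Eσ , ⊑-trans-any y∈t t∈L') var-in-t
      where
      var-in-t : VarC S y (subC S σ E) → var y ⊑ t
      var-in-t y∈Eσ with var-of-instance-clause y∈Eσ | literal-of-instance L'∈Eσ
      ... | x , x∈C , y∈σx | L , L∈C , refl
          with compound-of-instance-lit L (simple L L∈C) t∈L' t-compound
      ... | s , s∈L , s-compound , refl =
        ⊑-trans y∈σx (⊑-subst σ (Equivalence.from (covering s (L , L∈C , s∈L) s-compound x) x∈C))

    instance-ground : GroundC S C → GroundC S (subC S σ E)
    instance-ground ground y y∈Eσ = let x , x∈C , _ = var-of-instance-clause y∈Eσ in ground x x∈C

    -- The guards are negative literals, so they survive in E when E keeps
    -- every negative literal of C.
    module _ (negatives-kept : ∀ {G} → G ∈ C → Negative S G → G ∈ E) where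

      guard-instance : ∀ {G} → G ∈ C → Negative S G → subL S σ G ∈ subC S σ E
      guard-instance G∈C neg = ∈-map⁺ (subL S σ) (negatives-kept G∈C neg)

      instance-guarded : Guarded S C → Guarded S (subC S σ E)
      instance-guarded (simple , covering , inj₁ ground) =
        instance-simple simple , instance-covering simple covering , inj₁ (instance-ground ground)
      instance-guarded (simple , covering , inj₂ (G , G∈C , neg , G-flat , vars-of-G)) =
        instance-simple simple , instance-covering simple covering ,
        inj₂ (subL S σ G , guard-instance G∈C neg , negative-instance σ G neg ,
              flat-literal G G-flat , vars-of-Gσ)
        where
        vars-of-Gσ : ∀ y → VarL S y (subL S σ G) ⇔ VarC S y (subC S σ E)
        vars-of-Gσ y = mk⇔ (λ y∈Gσ → subL S σ G , guard-instance G∈C neg , y∈Gσ) λ y∈Eσ →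
          let x , x∈C , y∈σx = var-of-instance-clause y∈Eσ
          in  instance-var-lit σ G (Equivalence.from (vars-of-G x) x∈C) y∈σx

      instance-loosely-guarded : LooselyGuarded S C → LooselyGuarded S (subC S σ E)
      instance-loosely-guarded (simple , covering , inj₁ ground) =
        instance-simple simple , instance-covering simple covering , inj₁ (instance-ground ground)
      instance-loosely-guarded (simple , covering , inj₂ (𝒢 , guards , co-occur)) =
        instance-simple simple , instance-covering simple covering ,
        inj₂ (map (subL S σ) 𝒢 , guards-σ , co-occur-σ)
        where
        guards-σ : ∀ G' → G' ∈ map (subL S σ) 𝒢 → G' ∈ subC S σ E × Negative S G' × FlatL S G'
        guards-σ G' G'∈𝒢σ with ∈-map⁻ (subL S σ) G'∈𝒢σ
        ... | G , G∈𝒢 , refl =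
          let G∈C , neg , G-flat = guards G G∈𝒢
          in  guard-instance G∈C neg , negative-instance σ G neg , flat-literal G G-flat

        co-occur-σ : ∀ y₁ y₂ → VarC S y₁ (subC S σ E) → VarC S y₂ (subC S σ E) →
                     Σ (Literal S) λ G' → G' ∈ map (subL S σ) 𝒢 × VarL S y₁ G' × VarL S y₂ G'
        co-occur-σ y₁ y₂ y₁∈Eσ y₂∈Eσ =
          let x₁ , x₁∈C , y₁∈σx₁ = var-of-instance-clause y₁∈Eσ
              x₂ , x₂∈C , y₂∈σx₂ = var-of-instance-clause y₂∈Eσ
              G , G∈𝒢 , x₁∈G , x₂∈G = co-occur x₁ x₂ x₁∈C x₂∈C
          in  subL S σ G , ∈-map⁺ (subL S σ) G∈𝒢 ,
              instance-var-lit σ G x₁∈G y₁∈σx₁ , instance-var-lit σ G x₂∈G y₂∈σx₂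

  module FactConclusion {Sel : Selection S} {C C' : Clause S} (fact : Fact S Sel C C') where
    open Fact fact

    premise-literal : ∀ {L} → L ∈ lit true A₁ ∷ lit true A₂ ∷ D → L ∈ C
    premise-literal = ∈-resp-↭ (↭-sym shape)

    conclusion⊆premise : lit true A₁ ∷ D ⊆ C
    conclusion⊆premise (ListAny.here eq) = premise-literal (ListAny.here eq)
    conclusion⊆premise (ListAny.there L∈D) = premise-literal (ListAny.there (ListAny.there L∈D))

    negatives-kept : ∀ {G} → G ∈ C → Negative S G → G ∈ lit true A₁ ∷ D
    negatives-kept G∈C neg with ∈-resp-↭ shape G∈C
    negatives-kept G∈C () | ListAny.here refl
    negatives-kept G∈C () | ListAny.there (ListAny.here refl)
    ... | ListAny.there (ListAny.there G∈D) = ListAny.there G∈D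

    σ-flat : SimpleC S C → Covering S C → FlatSubst σ
    σ-flat simple covering =
      mgu-flat simple covering (premise-literal (ListAny.here refl))
        (premise-literal (ListAny.there (ListAny.here refl))) mgu

mainTheorem11 : (S : Signature) (Sel : Selection S) (C C' : Clause S) →
    Fact S Sel C C' →
    (Guarded S C → Guarded S C') × (LooselyGuarded S C → LooselyGuarded S C')
mainTheorem11 S Sel C C' fact =
  (λ guarded@(simple , covering , _) →
     subst (Guarded S) (sym result)
       (instance-guarded (σ-flat simple covering) conclusion⊆premise negatives-kept guarded)) ,
  (λ loosely@(simple , covering , _) →
     subst (LooselyGuarded S) (sym result)
       (instance-loosely-guarded (σ-flat simple covering) conclusion⊆premise negatives-kept loosely))
  where
  open FactConclusion S fact
  open Fact fact using (result)
  open SubclauseInstance S using (instance-guarded; instance-loosely-guarded)
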